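{- Let $g,c,n$ be integers with $3\le g\le c\le n$. The triplet $(g,c,n)$ is v-admissible if and only if either $g=c\le n$, or $g<c$ and $n\ge g-1+c/2$.
   Context: All graphs are finite, simple and connected. The girth (resp. circumference) of a graph is the length of a shortest (resp. longest) cycle. $\mathcal{G}(g,c,n)$ is the set of graphs with girth $g$, circumference $c$ and $n$ vertices; $(g,c,n)$ is v-admissible if $\mathcal{G}(g,c,n)\ne\emptyset$. -}

module Defs where

open import Data.Nat using (ℕ; suc; _≤_)
open import Data.Fin using (Fin; toℕ)
open import Data.Product using (Σ; _×_)
open import Data.Sum using (_⊎_)
open import Relation.Binary.PropositionalEquality using (_≡_)
open import Relation.Nullary using (¬_)
open import Function.Definitions using (Injective)

record Graph (n : ℕ) : Set₁ where
  field
    Adj   : Fin n → Fin n → Set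
    sym   : ∀ {u v} → Adj u v → Adj v u
    irref : ∀ {u} → ¬ Adj u u

open Graph public

data Reach {n : ℕ} (G : Graph n) : Fin n → Fin n → Set where
  here : ∀ {u} → Reach G u u
  step : ∀ {u v w} → Adj G u v → Reach G v w → Reach G u w

Connected : ∀ {n} → Graph n → Set
Connected G = ∀ u v → Reach G u v

Cycle : ∀ {n} → Graph n → ℕ → Set
Cycle {n} G k =
  3 ≤ k ×
  Σ (Fin k → Fin n) λ f →
    Injective _≡_ _≡_ f ×
    (∀ i j → (suc (toℕ i) ≡ toℕ j ⊎ (suc (toℕ i) ≡ k × toℕ j ≡ 0)) →
             Adj G (f i) (f j))

HasGirth : ∀ {n} → Graph n → ℕ → Set
HasGirth G g = Cycle G g × (∀ k → Cycle G k → g ≤ k)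

HasCircumference : ∀ {n} → Graph n → ℕ → Set
HasCircumference G c = Cycle G c × (∀ k → Cycle G k → k ≤ c)

VAdmissible : ℕ → ℕ → ℕ → Set₁
VAdmissible g c n =
  Σ (Graph n) λ G → Connected G × HasGirth G g × HasCircumference G c

module Submission where

-- Cycles are handled as periodic walks W : ℕ → vertices (CyclicWalk), so
-- that statements about cycles become arithmetic modulo their length, and
-- every count of vertices goes through injective maps out of an initial
-- segment of ℕ.
--
-- Necessity: let C be a longest and D a shortest cycle, g < c.  If D avoids
-- C, C and D give c + g vertices.  Otherwise D cannot run along edges of C
-- for a full turn (it would wind around C), so it leaves C at some vertex
-- and after ℓ steps returns to C: an ear whose ℓ - 1 inner vertices avoid C
-- (so c + ℓ - 1 ≤ n).  The ear splits C into arcs of lengths d + d' = c, and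
-- closing each arc by the ear gives cycles of lengths ≥ g, so 2g ≤ c + 2ℓ.
--
-- Sufficiency: the graph Θ has three internally disjoint branches between
-- two vertices 0 and a (the two arcs of a c-cycle and a bridge of length
-- e + 1) plus pendant vertices at 0.  Inner branch vertices have degree two,
-- so every cycle is the union of two branches; taking a = 1 and e = 0 gives
-- g = c, and taking a ≥ 2, e < a suitably gives girth a + e + 1 = g < c.

open import Defs renaming (sym to adj-sym)
open import Data.Nat using (ℕ; zero; suc; ⌊_/2⌋; _+_; _*_; _∸_; _≤_; _<_; z≤n; s≤s; _≟_; _≤?_; _<?_; pred)
open import Data.Nat.Properties
open import Data.Nat.DivMod
open import Data.Fin using (Fin; toℕ; fromℕ<)
import Data.Fin.Properties as Fin
open import Data.Product using (Σ; _×_; _,_; proj₁; proj₂)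
open import Data.Sum using (_⊎_; inj₁; inj₂; swap) renaming (map to map-⊎)
open import Data.Empty using (⊥; ⊥-elim)
open import Relation.Nullary using (¬_; Dec; yes; no)
open import Relation.Nullary.Decidable using (_×-dec_; _⊎-dec_; ¬?; decidable-stable)
open import Relation.Binary.PropositionalEquality
open import Relation.Binary using (tri<; tri≈; tri>)
open import Function.Definitions using (Injective)
open import Function.Bundles using (_⇔_; mk⇔)
open import Function.Base using (_∘_)
open import Data.Nat.Tactic.RingSolver using (solve-∀)

module Modular (m : ℕ) where
  private
    k : ℕ
    k = suc m

  %-cong-+ʳ : ∀ a b t → a % k ≡ b % k → (a + t) % k ≡ (b + t) % k
  %-cong-+ʳ a b t eq = begin
      (a + t) % k         ≡⟨ %-distribˡ-+ a t k ⟩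
      (a % k + t % k) % k ≡⟨ cong (λ z → (z + t % k) % k) eq ⟩
      (b % k + t % k) % k ≡⟨ %-distribˡ-+ b t k ⟨
      (b + t) % k         ∎
    where open ≡-Reasoning

  %-cancel-+ʳ : ∀ a b t → (a + t) % k ≡ (b + t) % k → a % k ≡ b % k
  %-cancel-+ʳ a b t eq = begin
      a % k                     ≡⟨ [m+kn]%n≡m%n a t k ⟨
      (a + t * k) % k           ≡⟨ cong (_% k) (complete a) ⟨
      (a + t + (t * k ∸ t)) % k ≡⟨ %-cong-+ʳ (a + t) (b + t) (t * k ∸ t) eq ⟩
      (b + t + (t * k ∸ t)) % k ≡⟨ cong (_% k) (complete b) ⟩
      (b + t * k) % k           ≡⟨ [m+kn]%n≡m%n b t k ⟩
      b % k                     ∎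
    where
    open ≡-Reasoning
    complete : ∀ x → x + t + (t * k ∸ t) ≡ x + t * k
    complete x = trans (+-assoc x t _) (cong (x +_) (m+[n∸m]≡n (m≤m*n t k)))

  private
    residue-+ : ∀ x d → d < k → (x + d) % k ≡ (x % k + d) % k
    residue-+ x d d<k = trans (%-distribˡ-+ x d k) (cong (λ z → (x % k + z) % k) (m<n⇒m%n≡m d<k))

  -- A shift by 0 < d < k changes the residue: with r = x % k, the residue of
  -- x + d is r + d or r + d ∸ k, and neither equals r.
  %-shift-≢ : ∀ x d → 0 < d → d < k → (x + d) % k ≢ x % k
  %-shift-≢ x d 0<d d<k eq with x % k + d <? k
  ... | yes r+d<k = <⇒≢ (m<m+n (x % k) 0<d) (sym (begin
      x % k + d       ≡⟨ m<n⇒m%n≡m r+d<k ⟨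
      (x % k + d) % k ≡⟨ residue-+ x d d<k ⟨
      (x + d) % k     ≡⟨ eq ⟩
      x % k           ∎))
    where open ≡-Reasoning
  ... | no r+d≮k = <⇒≢ d<k (+-cancelˡ-≡ (x % k) _ _ (begin
      x % k + d               ≡⟨ m∸n+n≡m k≤r+d ⟨
      (x % k + d) ∸ k + k     ≡⟨ cong (_+ k) wrapped ⟨
      (x % k + d) % k + k     ≡⟨ cong (_+ k) (trans (sym (residue-+ x d d<k)) eq) ⟩
      x % k + k               ∎))
    where
    open ≡-Reasoning
    k≤r+d : k ≤ x % k + d
    k≤r+d = ≮⇒≥ r+d≮k
    r+d∸k<k : x % k + d ∸ k < k
    r+d∸k<k = +-cancelʳ-< _ _ k
      (subst (_< k + k) (sym (m∸n+n≡m k≤r+d)) (+-mono-< (m%n<n x k) d<k))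
    wrapped : (x % k + d) % k ≡ x % k + d ∸ k
    wrapped = trans (sym (m≤n⇒[n∸m]%m≡n%m k≤r+d)) (m<n⇒m%n≡m r+d∸k<k)

  private
    regroup : ∀ p {u v} → u < v → p + u + (v ∸ u) ≡ p + v
    regroup p {u} u<v = trans (+-assoc p u _) (cong (p +_) (m+[n∸m]≡n (<⇒≤ u<v)))

  %-shift-injective : ∀ p t t' → (p + t) % k ≡ (p + t') % k → t < k → t' < k → t ≡ t'
  %-shift-injective p t t' eq t<k t'<k with <-cmp t t'
  ... | tri≈ _ t≡t' _ = t≡t'
  ... | tri< t<t' _ _ = ⊥-elim (%-shift-≢ (p + t) (t' ∸ t) (m<n⇒0<n∸m t<t')
          (≤-<-trans (m∸n≤m t' t) t'<k) (trans (cong (_% k) (regroup p t<t')) (sym eq)))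
  ... | tri> _ _ t'<t = ⊥-elim (%-shift-≢ (p + t') (t ∸ t') (m<n⇒0<n∸m t'<t)
          (≤-<-trans (m∸n≤m t t') t<k) (trans (cong (_% k) (regroup p t'<t)) eq))

LeastBelow : (ℕ → Set) → ℕ → Set
LeastBelow P N = Σ ℕ λ i → i < N × P i × (∀ j → j < i → ¬ P j)

least-below : (P : ℕ → Set) → (∀ i → Dec (P i)) → ∀ N →
              LeastBelow P N ⊎ (∀ i → i < N → ¬ P i)
least-below P P? zero = inj₂ (λ i ())
least-below P P? (suc N) with least-below P P? N
... | inj₁ (i , i<N , Pi , least) = inj₁ (i , m≤n⇒m≤1+n i<N , Pi , least)
... | inj₂ none with P? N
...   | yes PN = inj₁ (N , ≤-refl , PN , none)
...   | no ¬PN = inj₂ none′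
  where
  none′ : ∀ i → i < suc N → ¬ P i
  none′ i i<1+N with m<1+n⇒m<n∨m≡n i<1+N
  ... | inj₁ i<N = none i i<N
  ... | inj₂ refl = ¬PN

ExistsBelow : (ℕ → Set) → ℕ → Set
ExistsBelow P N = Σ ℕ λ i → i < N × P i

exists-below? : (P : ℕ → Set) → (∀ i → Dec (P i)) → ∀ N → Dec (ExistsBelow P N)
exists-below? P P? N with least-below P P? N
... | inj₁ (i , i<N , Pi , _) = yes (i , i<N , Pi)
... | inj₂ none = no λ (i , i<N , Pi) → none i i<N Pi

InjectiveOn : {A : Set} → (ℕ → Set) → (ℕ → A) → Set
InjectiveOn P f = ∀ a b → P a → P b → f a ≡ f b → a ≡ b

Inner : ℕ → ℕ → Set
Inner M j = 0 < j × j < M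

position-cases : ∀ {t L} → t ≤ L → t ≡ 0 ⊎ t ≡ L ⊎ Inner L t
position-cases {zero} _ = inj₁ refl
position-cases {suc t} t≤L with m≤n⇒m<n∨m≡n t≤L
... | inj₁ t<L = inj₂ (inj₂ (s≤s z≤n , t<L))
... | inj₂ t≡L = inj₂ (inj₁ t≡L)

injective-below⇒≤ : ∀ {M} (h : ℕ → Fin M) N → InjectiveOn (_< N) h → N ≤ M
injective-below⇒≤ {M} h N h-inj = Fin.injective⇒≤ {f = h ∘ toℕ} injective
  where
  injective : Injective _≡_ _≡_ (h ∘ toℕ)
  injective {i} {j} eq = Fin.toℕ-injective (h-inj _ _ (Fin.toℕ<n i) (Fin.toℕ<n j) eq)

module Splice {A : Set} (L : ℕ) (f h : ℕ → A) where
  splice : ℕ → A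
  splice t with t ≤? L
  ... | yes _ = f t
  ... | no _ = h (t ∸ L)

  splice-≤ : ∀ {t} → t ≤ L → splice t ≡ f t
  splice-≤ {t} t≤L with t ≤? L
  ... | yes _ = refl
  ... | no t≰L = ⊥-elim (t≰L t≤L)

  splice-> : ∀ {t} → ¬ t ≤ L → splice t ≡ h (t ∸ L)
  splice-> {t} t≰L with t ≤? L
  ... | yes t≤L = ⊥-elim (t≰L t≤L)
  ... | no _ = refl

  splice-≥ : f L ≡ h 0 → ∀ {t} → L ≤ t → splice t ≡ h (t ∸ L)
  splice-≥ junction {t} L≤t with t ≤? L
  ... | no _ = refl
  ... | yes t≤L rewrite ≤-antisym t≤L L≤t | n∸n≡0 L = junction

  second-index : ∀ {M t} → t < L + M → ¬ t ≤ L → Inner M (t ∸ L)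
  second-index {M} {t} t<L+M t≰L =
    m<n⇒0<n∸m L<t ,
    +-cancelˡ-< L _ _ (subst (_< L + M) (sym (m+[n∸m]≡n (<⇒≤ L<t))) t<L+M)
    where
    L<t : L < t
    L<t = ≰⇒> t≰L

  splice-injective : ∀ M → InjectiveOn (_≤ L) f → InjectiveOn (Inner M) h →
                     (∀ a b → a ≤ L → Inner M b → f a ≢ h b) →
                     InjectiveOn (_< L + M) splice
  splice-injective M f-inj h-inj disjoint a b a< b< eq = cases (a ≤? L) (b ≤? L)
    where
    cases : Dec (a ≤ L) → Dec (b ≤ L) → a ≡ b
    cases (yes a≤L) (yes b≤L) =
      f-inj a b a≤L b≤L (trans (sym (splice-≤ a≤L)) (trans eq (splice-≤ b≤L)))
    cases (yes a≤L) (no b≰L) = ⊥-elim (disjoint a _ a≤L (second-index b< b≰L)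
      (trans (sym (splice-≤ a≤L)) (trans eq (splice-> b≰L))))
    cases (no a≰L) (yes b≤L) = ⊥-elim (disjoint b _ b≤L (second-index a< a≰L)
      (trans (sym (splice-≤ b≤L)) (trans (sym eq) (splice-> a≰L))))
    cases (no a≰L) (no b≰L) = begin
      a             ≡⟨ m+[n∸m]≡n (<⇒≤ (≰⇒> a≰L)) ⟨
      L + (a ∸ L)   ≡⟨ cong (L +_) (h-inj _ _ (second-index a< a≰L) (second-index b< b≰L)
                         (trans (sym (splice-> a≰L)) (trans eq (splice-> b≰L)))) ⟩
      L + (b ∸ L)   ≡⟨ m+[n∸m]≡n (<⇒≤ (≰⇒> b≰L)) ⟩
      b             ∎
      where open ≡-Reasoning

-- This is how
-- "the cycle passes through one inner vertex of a path of degree-two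
-- vertices, hence through the whole path" is used.
propagate : (P : ℕ → Set) (L : ℕ) →
            (∀ i → Inner L i → P i → P (pred i) × P (suc i)) →
            ∀ i₀ → Inner L i₀ → P i₀ → ∀ i → i ≤ L → P i
propagate P L spread i₀ inner₀ P₀ i i≤L with i₀ ≤? i
... | yes i₀≤i = subst P (m+[n∸m]≡n i₀≤i)
        (up (i ∸ i₀) (subst (_≤ L) (sym (m+[n∸m]≡n i₀≤i)) i≤L))
  where
  up : ∀ d → i₀ + d ≤ L → P (i₀ + d)
  up zero _ = subst P (sym (+-identityʳ i₀)) P₀
  up (suc d) i₀+1+d≤L = subst P (sym (+-suc i₀ d))
     (proj₂ (spread (i₀ + d) (<-≤-trans (proj₁ inner₀) (m≤m+n i₀ d) , i₀+d<L) (up d (<⇒≤ i₀+d<L))))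
    where
    i₀+d<L : i₀ + d < L
    i₀+d<L = subst (_≤ L) (+-suc i₀ d) i₀+1+d≤L
... | no i₀≰i = subst P (m∸[m∸n]≡n (<⇒≤ (≰⇒> i₀≰i))) (down (i₀ ∸ i) (m∸n≤m i₀ i))
  where
  down : ∀ d → d ≤ i₀ → P (i₀ ∸ d)
  down zero _ = P₀
  down (suc d) 1+d≤i₀ = subst P (pred[m∸n]≡m∸[1+n] i₀ d)
     (proj₁ (spread (i₀ ∸ d) (m<n⇒0<n∸m 1+d≤i₀ , ≤-<-trans (m∸n≤m i₀ d) (proj₂ inner₀))
       (down d (≤-trans (n≤1+n d) 1+d≤i₀))))

reach-trans : ∀ {n} {G : Graph n} {u v w} → Reach G u v → Reach G v w → Reach G u w
reach-trans here r = r
reach-trans (step a r) r' = step a (reach-trans r r')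

reach-sym : ∀ {n} {G : Graph n} {u v} → Reach G u v → Reach G v u
reach-sym here = here
reach-sym {G = G} (step a r) = reach-trans (reach-sym r) (step (adj-sym G a) here)

connected-via-root : ∀ {n} {G : Graph n} r → (∀ v → Reach G v r) → Connected G
connected-via-root r to-root u v = reach-trans (to-root u) (reach-sym (to-root v))

-- A cycle of length suc m, unrolled into a periodic walk: W t is the vertex
-- visited at time t, and two times visit the same vertex exactly when they
-- are congruent modulo suc m.
record CyclicWalk {n} (G : Graph n) (m : ℕ) : Set where
  field
    W         : ℕ → Fin n
    adj       : ∀ t → Adj G (W t) (W (suc t))
    injective : ∀ a b → W a ≡ W b → a % suc m ≡ b % suc m
    periodic  : ∀ a b → a % suc m ≡ b % suc m → W a ≡ W b

-- The residue of suc t is suc (t % k), unless that equals k and wraps to 0;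
-- this is exactly the successor relation of the Cycle definition.
module _ (m : ℕ) where
  private
    k : ℕ
    k = suc (suc m)

  suc-% : ∀ t → suc (t % k) ≡ suc t % k ⊎ (suc (t % k) ≡ k × suc t % k ≡ 0)
  suc-% t with suc (t % k) <? k
  ... | yes 1+r<k = inj₁ (sym (trans (%-distribˡ-+ 1 t k) (m<n⇒m%n≡m 1+r<k)))
  ... | no 1+r≮k = inj₂ (wraps , trans (%-distribˡ-+ 1 t k) (trans (cong (_% k) wraps) (n%n≡0 k)))
    where
    wraps : suc (t % k) ≡ k
    wraps = ≤-antisym (m%n<n t k) (≮⇒≥ 1+r≮k)

cycle⇒cyclicWalk : ∀ {n} {G : Graph n} {k} → Cycle G k →
                   Σ ℕ λ m → k ≡ suc m × 2 ≤ m × CyclicWalk G m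
cycle⇒cyclicWalk {n} {G} {suc (suc (suc m))} (s≤s (s≤s (s≤s z≤n)) , f , f-inj , f-adj) =
  suc (suc m) , refl , s≤s (s≤s z≤n) ,
  record { W = W ; adj = adj ; injective = injective ; periodic = periodic }
  where
  k = suc (suc (suc m))
  index : ℕ → Fin k
  index t = fromℕ< (m%n<n t k)
  toℕ-index : ∀ t → toℕ (index t) ≡ t % k
  toℕ-index t = Fin.toℕ-fromℕ< (m%n<n t k)
  W : ℕ → Fin n
  W t = f (index t)
  adj : ∀ t → Adj G (W t) (W (suc t))
  adj t = f-adj (index t) (index (suc t))
    (subst₂ (λ x y → suc x ≡ y ⊎ (suc x ≡ k × y ≡ 0))
      (sym (toℕ-index t)) (sym (toℕ-index (suc t))) (suc-% (suc m) t))
  injective : ∀ a b → W a ≡ W b → a % k ≡ b % k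
  injective a b eq = trans (sym (toℕ-index a)) (trans (cong toℕ (f-inj eq)) (toℕ-index b))
  periodic : ∀ a b → a % k ≡ b % k → W a ≡ W b
  periodic a b eq = cong f (Fin.fromℕ<-cong _ _ eq (m%n<n a k) (m%n<n b k))

walk⇒cycle : ∀ {n} {G : Graph n} k → 3 ≤ k → (V : ℕ → Fin n) →
             (∀ t → suc t < k → Adj G (V t) (V (suc t))) → Adj G (V (pred k)) (V 0) →
             InjectiveOn (_< k) V → Cycle G k
walk⇒cycle {n} {G} k 3≤k V V-adj V-close V-inj =
  3≤k , V ∘ toℕ , (λ eq → Fin.toℕ-injective (V-inj _ _ (Fin.toℕ<n _) (Fin.toℕ<n _) eq)) , consecutive
  where
  consecutive : ∀ i j → (suc (toℕ i) ≡ toℕ j ⊎ (suc (toℕ i) ≡ k × toℕ j ≡ 0)) →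
                Adj G (V (toℕ i)) (V (toℕ j))
  consecutive i j (inj₁ next) =
    subst (Adj G (V (toℕ i)) ∘ V) next (V-adj (toℕ i) (subst (_< k) (sym next) (Fin.toℕ<n j)))
  consecutive i j (inj₂ (last , first)) =
    subst₂ (λ x y → Adj G (V x) (V y)) (sym (cong pred last)) (sym first) V-close

IsWalk : ∀ {n} → Graph n → (ℕ → Fin n) → ℕ → Set
IsWalk G P L = ∀ t → t < L → Adj G (P t) (P (suc t))

reverse-walk : ∀ {n} {G : Graph n} {P L} → IsWalk G P L → IsWalk G (λ t → P (L ∸ t)) L
reverse-walk {G = G} {P} {L} walk t t<L =
  subst (λ j → Adj G (P j) (P (L ∸ suc t))) (sym (+-∸-assoc 1 t<L))
    (adj-sym G (walk (L ∸ suc t) (∸-monoʳ-< (s≤s z≤n) t<L)))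

mirror : ∀ {L i} → Inner L i → Inner L (L ∸ i)
mirror {L} {suc i} (_ , i<L) = m<n⇒0<n∸m i<L , ∸-monoʳ-< (s≤s z≤n) (<⇒≤ i<L)

mirror-injective : ∀ {A : Set} {L} (f : ℕ → A) → InjectiveOn (Inner L) f →
                   InjectiveOn (Inner L) (λ i → f (L ∸ i))
mirror-injective {L = L} f f-inj a b inner-a inner-b eq =
  ∸-cancelˡ-≡ (<⇒≤ (proj₂ inner-a)) (<⇒≤ (proj₂ inner-b)) (f-inj _ _ (mirror inner-a) (mirror inner-b) eq)

two-walks⇒cycle : ∀ {n} {G : Graph n} L M (P Q : ℕ → Fin n) → 0 < M → 3 ≤ L + M →
                  IsWalk G P L → IsWalk G Q M → P L ≡ Q 0 → Q M ≡ P 0 →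
                  InjectiveOn (_≤ L) P → InjectiveOn (Inner M) Q →
                  (∀ a b → a ≤ L → Inner M b → P a ≢ Q b) → Cycle G (L + M)
two-walks⇒cycle {n} {G} L (suc M) P Q _ 3≤ P-walk Q-walk junction closing P-inj Q-inj disjoint =
  walk⇒cycle {G = G} (L + suc M) 3≤ splice V-adj V-close (splice-injective (suc M) P-inj Q-inj disjoint)
  where
  open Splice L P Q
  V-adj : ∀ t → suc t < L + suc M → Adj G (splice t) (splice (suc t))
  V-adj t 1+t<L+M = by-part (suc t ≤? L)
    where
    by-part : Dec (suc t ≤ L) → Adj G (splice t) (splice (suc t))
    by-part (yes 1+t≤L) = subst₂ (Adj G) (sym (splice-≤ (≤-trans (n≤1+n t) 1+t≤L)))
      (sym (splice-≤ 1+t≤L)) (P-walk t 1+t≤L)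
    by-part (no 1+t≰L) = subst₂ (Adj G) (sym (splice-≥ junction L≤t))
      (trans (cong Q (sym (+-∸-assoc 1 L≤t))) (sym (splice-≥ junction (≤-trans L≤t (n≤1+n t)))))
      (Q-walk (t ∸ L) (+-cancelˡ-< L _ _
        (subst (_< L + suc M) (sym (m+[n∸m]≡n L≤t)) (<-trans (n<1+n t) 1+t<L+M))))
      where
      L≤t : L ≤ t
      L≤t = ≤-pred (≰⇒> 1+t≰L)
  V-close : Adj G (splice (pred (L + suc M))) (splice 0)
  V-close = subst₂ (Adj G)
    (sym (trans (cong (splice ∘ pred) (+-suc L M)) (trans (splice-≥ junction (m≤m+n L M)) (cong Q (m+n∸m≡n L M)))))
    (sym (trans (splice-≤ z≤n) (sym closing)))
    (Q-walk M ≤-refl)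

pigeonhole-3-2 : ∀ {A : Set} {x y p q r : A} → p ≢ q → q ≢ r → p ≢ r →
                 (p ≡ x ⊎ p ≡ y) → (q ≡ x ⊎ q ≡ y) → (r ≡ x ⊎ r ≡ y) → ⊥
pigeonhole-3-2 p≢q q≢r p≢r (inj₁ a) (inj₁ b) _ = p≢q (trans a (sym b))
pigeonhole-3-2 p≢q q≢r p≢r (inj₂ a) (inj₂ b) _ = p≢q (trans a (sym b))
pigeonhole-3-2 p≢q q≢r p≢r (inj₁ a) (inj₂ b) (inj₁ c) = p≢r (trans a (sym c))
pigeonhole-3-2 p≢q q≢r p≢r (inj₁ a) (inj₂ b) (inj₂ c) = q≢r (trans b (sym c))
pigeonhole-3-2 p≢q q≢r p≢r (inj₂ a) (inj₁ b) (inj₁ c) = q≢r (trans b (sym c))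
pigeonhole-3-2 p≢q q≢r p≢r (inj₂ a) (inj₁ b) (inj₂ c) = p≢r (trans a (sym c))

module OnCyclicWalk {n} {G : Graph n} {m} (2≤m : 2 ≤ m) (C : CyclicWalk G m) where
  open CyclicWalk C public
  open Modular m

  k : ℕ
  k = suc m

  OnCycle : Fin n → Set
  OnCycle v = Σ ℕ λ t → W t ≡ v

  -- W (t + m) is the vertex visited just before W t.
  adj-pred : ∀ t → Adj G (W (t + m)) (W t)
  adj-pred t = subst (Adj G (W (t + m))) (trans (cong W (sym (+-suc t m)))
                 (periodic _ _ ([m+n]%n≡m%n t k))) (adj (t + m))

  -- The two cycle-neighbours of W t are distinct, since k ≥ 3.
  neighbours-≢ : ∀ t → W (suc t) ≢ W (t + m)
  neighbours-≢ t eq = %-shift-≢ (suc t) (m ∸ 1) (∸-monoˡ-≤ 1 2≤m) (s≤s (m∸n≤m m 1))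
    (trans (cong (_% k) (trans (sym (+-suc t (m ∸ 1))) (cong (t +_) (m+[n∸m]≡n (≤-trans (s≤s z≤n) 2≤m)))))
           (sym (injective _ _ eq)))

  -- A cycle does not live inside two vertices: W 0, W 1, W 2 are distinct.
  not-within-two : ∀ {P : Set} x y → (∀ t → (W t ≡ x ⊎ W t ≡ y) ⊎ P) → P
  not-within-two x y classify with classify 0 | classify 1 | classify 2
  ... | inj₂ p | _ | _ = p
  ... | _ | inj₂ p | _ = p
  ... | _ | _ | inj₂ p = p
  ... | inj₁ in₀ | inj₁ in₁ | inj₁ in₂ =
    ⊥-elim (pigeonhole-3-2 (consecutive-≢ 0) (consecutive-≢ 1) W₀≢W₂ in₀ in₁ in₂)
    where
    consecutive-≢ : ∀ t → W t ≢ W (suc t)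
    consecutive-≢ t eq = irref G (subst (λ v → Adj G v (W (suc t))) eq (adj t))
    W₀≢W₂ : W 0 ≢ W 2
    W₀≢W₂ eq = %-shift-≢ 0 2 (s≤s z≤n) (s≤s 2≤m) (sym (injective _ _ eq))

  no-pendant-on-cycle : ∀ t {u} → (∀ x → Adj G (W t) x → x ≡ u) → ⊥
  no-pendant-on-cycle t only-u =
    neighbours-≢ t (trans (only-u _ (adj t)) (sym (only-u _ (adj-sym G (adj-pred t)))))

  Neighbours⊆ : Fin n → Fin n → Fin n → Set
  Neighbours⊆ v u w = ∀ x → Adj G v x → x ≡ u ⊎ x ≡ w

  degree-two : ∀ t {u w} → Neighbours⊆ (W t) u w →
               (W (suc t) ≡ u ⊎ W (t + m) ≡ u) × (W (suc t) ≡ w ⊎ W (t + m) ≡ w)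
  degree-two t only-uw with only-uw _ (adj t) | only-uw _ (adj-sym G (adj-pred t))
  ... | inj₁ a | inj₁ b = ⊥-elim (neighbours-≢ t (trans a (sym b)))
  ... | inj₂ a | inj₂ b = ⊥-elim (neighbours-≢ t (trans a (sym b)))
  ... | inj₁ a | inj₂ b = inj₁ a , inj₂ b
  ... | inj₂ a | inj₁ b = inj₂ b , inj₁ a

  degree-two-on-cycle : ∀ t {u w} → Neighbours⊆ (W t) u w → OnCycle u × OnCycle w
  degree-two-on-cycle t only-uw with degree-two t only-uw
  ... | used-u , used-w = visited used-u , visited used-w
    where
    visited : ∀ {v} → (W (suc t) ≡ v ⊎ W (t + m) ≡ v) → OnCycle v
    visited (inj₁ eq) = suc t , eq
    visited (inj₂ eq) = t + m , eq

  degree-two-neighbour : ∀ s {x w} → OnCycle x → Neighbours⊆ x (W s) w →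
                         x ≡ W (suc s) ⊎ x ≡ W (s + m)
  degree-two-neighbour s (t , refl) only = by-time (proj₁ (degree-two t only))
    where
    by-time : (W (suc t) ≡ W s ⊎ W (t + m) ≡ W s) → W t ≡ W (suc s) ⊎ W t ≡ W (s + m)
    by-time (inj₁ eq) = inj₂ (periodic _ _ (trans (sym ([m+n]%n≡m%n t k))
      (trans (cong (_% k) (+-suc t m)) (%-cong-+ʳ (suc t) s m (injective _ _ eq)))))
    by-time (inj₂ eq) = inj₁ (periodic _ _ (trans (sym ([m+n]%n≡m%n t k))
      (trans (cong (_% k) (trans (+-suc t m) (+-comm 1 (t + m))))
        (trans (%-cong-+ʳ (t + m) s 1 (injective _ _ eq)) (cong (_% k) (+-comm s 1))))))

  on-cycle-count : (h : ℕ → Fin n) (N : ℕ) → InjectiveOn (_< N) h →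
                   (∀ a → a < N → OnCycle (h a)) → N ≤ k
  on-cycle-count h N h-inj on = Fin.injective⇒≤ {f = slot} slot-injective
    where
    time : Fin N → ℕ
    time i = proj₁ (on (toℕ i) (Fin.toℕ<n i))
    slot : Fin N → Fin k
    slot i = fromℕ< (m%n<n (time i) k)
    visit : ∀ i → W (time i) ≡ h (toℕ i)
    visit i = proj₂ (on (toℕ i) (Fin.toℕ<n i))
    slot-injective : Injective _≡_ _≡_ slot
    slot-injective {i} {j} eq = Fin.toℕ-injective (h-inj _ _ (Fin.toℕ<n i) (Fin.toℕ<n j) (begin
      h (toℕ i)    ≡⟨ visit i ⟨
      W (time i)   ≡⟨ periodic _ _ same-residue ⟩
      W (time j)   ≡⟨ visit j ⟩
      h (toℕ j)    ∎))
      where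
      open ≡-Reasoning
      same-residue : time i % k ≡ time j % k
      same-residue = trans (sym (Fin.toℕ-fromℕ< _)) (trans (cong toℕ eq) (Fin.toℕ-fromℕ< _))

  length-≤-cover : (U : ℕ → Fin n) (M : ℕ) → (∀ t → Σ ℕ λ x → x < M × U x ≡ W t) → k ≤ M
  length-≤-cover U M cover = injective-below⇒≤ label k label-injective
    where
    label : ℕ → Fin M
    label t = fromℕ< (proj₁ (proj₂ (cover t)))
    label-injective : InjectiveOn (_< k) label
    label-injective a b a<k b<k eq = begin
      a           ≡⟨ m<n⇒m%n≡m a<k ⟨
      a % k       ≡⟨ injective _ _ (trans (sym (proj₂ (proj₂ (cover a))))
                       (trans (cong U same-x) (proj₂ (proj₂ (cover b))))) ⟩
      b % k       ≡⟨ m<n⇒m%n≡m b<k ⟩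
      b           ∎
      where
      open ≡-Reasoning
      same-x : proj₁ (cover a) ≡ proj₁ (cover b)
      same-x = trans (sym (Fin.toℕ-fromℕ< _)) (trans (cong toℕ eq) (Fin.toℕ-fromℕ< _))

module Necessity {n} {G : Graph n} (mc mg : ℕ) (2≤mg : 2 ≤ mg) (g<c : suc mg < suc mc)
                 (C : CyclicWalk G mc) (D : CyclicWalk G mg) where
  c g : ℕ
  c = suc mc
  g = suc mg
  module C = CyclicWalk C
  module D = CyclicWalk D
  module ModC = Modular mc
  module ModD = Modular mg

  -- v lies on C (at a position below c, so that this is decidable).
  OnC : Fin n → Set
  OnC v = ExistsBelow (λ p → C.W p ≡ v) c

  on-C : ∀ {v} t → C.W t ≡ v → OnC v
  on-C t eq = t % c , m%n<n t c , trans (C.periodic _ _ (m%n%n≡m%n t c)) eq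

  OnC? : ∀ v → Dec (OnC v)
  OnC? v = exists-below? _ (λ p → C.W p Fin.≟ v) c

  CEdge : Fin n → Fin n → Set
  CEdge u v = ExistsBelow (λ p → (C.W p ≡ u × C.W (suc p) ≡ v) ⊎ (C.W p ≡ v × C.W (suc p) ≡ u)) c

  CEdge? : ∀ u v → Dec (CEdge u v)
  CEdge? u v = exists-below? _ (λ p → (C.W p Fin.≟ u ×-dec C.W (suc p) Fin.≟ v)
                                      ⊎-dec (C.W p Fin.≟ v ×-dec C.W (suc p) Fin.≟ u)) c

  ear-count : ∀ s L → L < g → (∀ i → i < L → ¬ OnC (D.W (suc s + i))) → c + L ≤ n
  ear-count s L L<g off = subst (_≤ n) (+-suc mc L)
    (injective-below⇒≤ splice (mc + suc L) (splice-injective (suc L) C-inj D-inj disjoint))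
    where
    open Splice mc C.W (λ j → D.W (s + j))
    C-inj : InjectiveOn (_≤ mc) C.W
    C-inj a b a≤mc b≤mc eq = trans (sym (m<n⇒m%n≡m (s≤s a≤mc)))
      (trans (C.injective _ _ eq) (m<n⇒m%n≡m (s≤s b≤mc)))
    D-inj : InjectiveOn (Inner (suc L)) (λ j → D.W (s + j))
    D-inj a b (_ , a≤L) (_ , b≤L) eq =
      ModD.%-shift-injective s a b (D.injective _ _ eq) (<-≤-trans a≤L L<g) (<-≤-trans b≤L L<g)
    disjoint : ∀ a b → a ≤ mc → Inner (suc L) b → C.W a ≢ D.W (s + b)
    disjoint a (suc i) a≤mc (_ , s≤s i<L) eq =
      off i i<L (on-C a (trans eq (cong D.W (+-suc s i))))

  -- D cannot run along edges of C for a full turn: going forward it would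
  -- close up after g < c steps of C, and turning back it would repeat a
  -- vertex after two steps.
  module Winding (s₀ : ℕ) (along : ∀ t → t < g → CEdge (D.W (s₀ + t)) (D.W (s₀ + suc t))) where
    D′ : ℕ → Fin n
    D′ t = D.W (s₀ + t)

    no-backtrack : ∀ t → D′ (suc (suc t)) ≢ D′ t
    no-backtrack t eq = ModD.%-shift-≢ (s₀ + t) 2 (s≤s z≤n) (s≤s 2≤mg)
      (trans (cong (_% g) (trans (+-assoc s₀ t 2) (cong (s₀ +_) (+-comm t 2)))) (D.injective _ _ eq))

    closes : D′ g ≡ D′ 0
    closes = D.periodic _ _ (trans ([m+n]%n≡m%n s₀ g) (cong (_% g) (sym (+-identityʳ s₀))))

    C-next : ∀ {a b} → C.W a ≡ C.W b → C.W (suc a) ≡ C.W (suc b)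
    C-next {a} {b} eq = C.periodic _ _ (trans (cong (_% c) (+-comm 1 a))
      (trans (ModC.%-cong-+ʳ a b 1 (C.injective _ _ eq)) (cong (_% c) (+-comm b 1))))

    C-prev : ∀ {a b} → C.W (suc a) ≡ C.W (suc b) → C.W a ≡ C.W b
    C-prev {a} {b} eq = C.periodic _ _ (ModC.%-cancel-+ʳ a b 1
      (trans (cong (_% c) (+-comm a 1)) (trans (C.injective _ _ eq) (cong (_% c) (+-comm 1 b)))))

    -- If D′ starts with the C-edge C.W p → C.W (p + 1), it follows C forward.
    forward : ∀ p → C.W p ≡ D′ 0 → C.W (suc p) ≡ D′ 1 → ⊥
    forward p start next = ModC.%-shift-≢ p g (s≤s z≤n) g<c
      (C.injective _ _ (trans (sym (proj₂ (follows mg ≤-refl))) (trans closes (sym start))))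
      where
      follows : ∀ t → suc t ≤ g → D′ t ≡ C.W (p + t) × D′ (suc t) ≡ C.W (p + suc t)
      follows zero _ = trans (sym start) (cong C.W (sym (+-identityʳ p))) ,
                       trans (sym next) (cong C.W (sym (+-comm p 1)))
      follows (suc t) 2+t≤g with follows t (≤-trans (n≤1+n _) 2+t≤g) | along (suc t) 2+t≤g
      ... | _ , here₁ | _ , _ , inj₁ (from , to) =
            here₁ , trans (sym to) (trans (C-next (trans from here₁)) (cong C.W (sym (+-suc p (suc t)))))
      ... | here₀ , here₁ | _ , _ , inj₂ (to , from) = ⊥-elim (no-backtrack t
            (trans (sym to) (trans (C-prev (trans from (trans here₁ (cong C.W (+-suc p t))))) (sym here₀))))

    -- If it starts with C.W (r + 1) → C.W r, it follows C backward.
    backward : ∀ r → C.W r ≡ D′ 1 → C.W (suc r) ≡ D′ 0 → ⊥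
    backward r next start with follows mg ≤-refl
      where
      follows : ∀ t → suc t ≤ g →
                Σ ℕ λ x → D′ (suc t) ≡ C.W x × D′ t ≡ C.W (suc x) × (x + suc t) % c ≡ suc r % c
      follows zero _ = r , sym next , sym start , cong (_% c) (+-comm r 1)
      follows (suc t) 2+t≤g with follows t (≤-trans (n≤1+n _) 2+t≤g) | along (suc t) 2+t≤g
      ... | x , here₁ , here₀ , _ | _ , _ , inj₁ (from , to) = ⊥-elim (no-backtrack t
            (trans (sym to) (trans (C-next (trans from here₁)) (sym here₀))))
      ... | x , here₁ , _ , winding | r′ , _ , inj₂ (to , from) =
            r′ , sym to , sym from ,
            trans (cong (_% c) (+-suc r′ (suc t)))
                  (trans (ModC.%-cong-+ʳ (suc r′) x (suc t) (C.injective _ _ (trans from here₁))) winding)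
    ... | x , here-g , _ , winding = ModC.%-shift-≢ x g (s≤s z≤n) g<c
          (trans winding (C.injective _ _ (trans start (trans (sym closes) here-g))))

    impossible : ⊥
    impossible with along 0 (s≤s z≤n)
    ... | p , _ , inj₁ (from , to) = forward p from to
    ... | p , _ , inj₂ (to , from) = backward p to from

  record Ear (x y : Fin n) (ℓ : ℕ) : Set where
    field
      P        : ℕ → Fin n
      start    : P 0 ≡ x
      end      : P ℓ ≡ y
      walk     : IsWalk G P ℓ
      off-C    : ∀ i → Inner ℓ i → ¬ OnC (P i)
      distinct : InjectiveOn (Inner ℓ) P

  reverse : ∀ {x y ℓ} → Ear x y ℓ → Ear y x ℓ
  reverse {ℓ = ℓ} E = record
    { P        = λ i → P (ℓ ∸ i)
    ; start    = end
    ; end      = trans (cong P (n∸n≡0 ℓ)) start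
    ; walk     = reverse-walk {G = G} {P} walk
    ; off-C    = λ i inner → off-C (ℓ ∸ i) (mirror inner)
    ; distinct = mirror-injective P distinct
    }
    where open Ear E

  D-ear : ∀ s i → suc i < g → (∀ j → j < i → ¬ OnC (D.W (suc s + j))) →
          Ear (D.W s) (D.W (suc s + i)) (suc i)
  D-ear s i ℓ<g off = record
    { P        = λ j → D.W (s + j)
    ; start    = cong D.W (+-identityʳ s)
    ; end      = cong D.W (+-suc s i)
    ; walk     = λ j _ → subst (Adj G (D.W (s + j)) ∘ D.W) (sym (+-suc s j)) (D.adj (s + j))
    ; off-C    = λ { (suc j) (_ , s≤s j<i) on → off j j<i (subst OnC (cong D.W (+-suc s j)) on) }
    ; distinct = λ a b (_ , a<ℓ) (_ , b<ℓ) eq → ModD.%-shift-injective s a b (D.injective _ _ eq)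
                   (<-trans a<ℓ ℓ<g) (<-trans b<ℓ ℓ<g)
    }

  arc+ear-cycle : ∀ p d {ℓ} → d < c → 3 ≤ d + suc ℓ → Ear (C.W (p + d)) (C.W p) (suc ℓ) →
                  Cycle G (d + suc ℓ)
  arc+ear-cycle p d {ℓ} d<c 3≤ E =
    two-walks⇒cycle {G = G} d (suc ℓ) (λ t → C.W (p + t)) P (s≤s z≤n) 3≤
      (λ t _ → subst (Adj G (C.W (p + t)) ∘ C.W) (sym (+-suc p t)) (C.adj (p + t)))
      walk (sym start) (trans end (cong C.W (sym (+-identityʳ p))))
      (λ a b a≤d b≤d eq → ModC.%-shift-injective p a b (C.injective _ _ eq) (≤-<-trans a≤d d<c) (≤-<-trans b≤d d<c))
      distinct
      (λ a b _ inner eq → off-C b inner (on-C (p + a) eq))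
    where open Ear E

  Arcs : ℕ → ℕ → Set
  Arcs p q = Σ ℕ λ d → Σ ℕ λ d' → 1 ≤ d × 1 ≤ d' × d + d' ≡ c ×
             C.W (p + d) ≡ C.W q × C.W (q + d') ≡ C.W p

  arcs-< : ∀ p q → p < q → q < c → Arcs p q
  arcs-< p q p<q q<c =
    d , c ∸ d , m<n⇒0<n∸m p<q , m<n⇒0<n∸m d<c , m+[n∸m]≡n (<⇒≤ d<c) ,
    cong C.W (m+[n∸m]≡n (<⇒≤ p<q)) , C.periodic _ _ (trans (cong (_% c) around) ([m+n]%n≡m%n p c))
    where
    d = q ∸ p
    d<c : d < c
    d<c = ≤-<-trans (m∸n≤m q p) q<c
    around : q + (c ∸ d) ≡ p + c
    around = trans (cong (_+ (c ∸ d)) (sym (m+[n∸m]≡n (<⇒≤ p<q))))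
               (trans (+-assoc p d _) (cong (p +_) (m+[n∸m]≡n (<⇒≤ d<c))))

  arcs : ∀ p q → p < c → q < c → p ≢ q → Arcs p q
  arcs p q p<c q<c p≢q with <-cmp p q
  ... | tri< p<q _ _ = arcs-< p q p<q q<c
  ... | tri≈ _ p≡q _ = ⊥-elim (p≢q p≡q)
  ... | tri> _ _ q<p with arcs-< q p q<p p<c
  ...   | d , d' , 1≤d , 1≤d' , d+d'≡c , q+d , p+d' = d' , d , 1≤d' , 1≤d , trans (+-comm d' d) d+d'≡c , p+d' , q+d

  arc+ear-≥3 : ∀ d ℓ → 1 ≤ d → (d ≡ 1 → ℓ ≡ 0 → ⊥) → 3 ≤ d + suc ℓ
  arc+ear-≥3 d (suc ℓ) 1≤d _ = ≤-trans (s≤s (s≤s (s≤s z≤n))) (+-monoˡ-≤ (suc (suc ℓ)) 1≤d)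
  arc+ear-≥3 (suc (suc d)) zero _ _ = s≤s (s≤s (m≤n+m 1 d))
  arc+ear-≥3 (suc zero) zero _ single = ⊥-elim (single refl refl)

  -- If D is a shortest cycle, an ear between distinct vertices of C that is
  -- not an edge of C has length ℓ + 1 with 2g ≤ c + 2(ℓ + 1): both arcs of C
  -- closed by the ear are cycles, of total length c + 2(ℓ + 1).
  ear-bound : (∀ k → Cycle G k → g ≤ k) →
              ∀ {p q ℓ} → p < c → q < c → p ≢ q → (ℓ ≡ 0 → ¬ CEdge (C.W p) (C.W q)) →
              Ear (C.W p) (C.W q) (suc ℓ) → 2 * g ≤ c + 2 * suc ℓ
  ear-bound girth {p} {q} {ℓ} p<c q<c p≢q not-edge E with arcs p q p<c q<c p≢q
  ... | d , d' , 1≤d , 1≤d' , d+d'≡c , p+d , q+d' = begin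
    2 * g                               ≡⟨⟩
    g + (g + 0)                         ≤⟨ +-mono-≤ (girth _ cycle₁) (+-monoˡ-≤ 0 (girth _ cycle₂)) ⟩
    (d + suc ℓ) + ((d' + suc ℓ) + 0)    ≡⟨ total d d' (suc ℓ) ⟩
    (d + d') + 2 * suc ℓ                ≡⟨ cong (_+ 2 * suc ℓ) d+d'≡c ⟩
    c + 2 * suc ℓ                       ∎
    where
    open ≤-Reasoning
    total : ∀ d d' ℓ → (d + ℓ) + ((d' + ℓ) + 0) ≡ (d + d') + 2 * ℓ
    total = solve-∀
    cycle₁ : Cycle G (d + suc ℓ)
    cycle₁ = arc+ear-cycle p d (subst (d <_) d+d'≡c (m<m+n d 1≤d'))
      (arc+ear-≥3 d ℓ 1≤d λ { refl refl → not-edge refl (p , p<c , inj₁ (refl , trans (cong C.W (+-comm 1 p)) p+d)) })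
      (subst (λ x → Ear x (C.W p) (suc ℓ)) (sym p+d) (reverse E))
    cycle₂ : Cycle G (d' + suc ℓ)
    cycle₂ = arc+ear-cycle q d' (subst (d' <_) (trans (+-comm d' d) d+d'≡c) (m<m+n d' 1≤d))
      (arc+ear-≥3 d' ℓ 1≤d' λ { refl refl → not-edge refl (q , q<c , inj₂ (refl , trans (cong C.W (+-comm 1 q)) q+d')) })
      (subst (λ x → Ear x (C.W q) (suc ℓ)) (sym q+d') E)

  combine : ∀ i → c + i ≤ n → 2 * g ≤ c + 2 * suc i → 2 * g + c ≤ 2 * n + 2
  combine i count ear = begin
    2 * g + c               ≤⟨ +-monoˡ-≤ c ear ⟩
    c + 2 * suc i + c       ≡⟨ regroup c i ⟩
    2 * (c + i) + 2         ≤⟨ +-monoˡ-≤ 2 (*-monoʳ-≤ 2 count) ⟩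
    2 * n + 2               ∎
    where
    open ≤-Reasoning
    regroup : ∀ c i → c + 2 * suc i + c ≡ 2 * (c + i) + 2
    regroup = solve-∀

  module Shortest (girth : ∀ k → Cycle G k → g ≤ k) where

    -- D leaves C at time s through an edge not on C.  Its next visit of C,
    -- after i + 1 steps, closes an ear with i vertices off C.
    leaving-C : ∀ s → OnC (D.W s) → ¬ CEdge (D.W s) (D.W (suc s)) → 2 * g + c ≤ 2 * n + 2
    leaving-C s on-s@(p , p<c , p-s) not-edge with least-below (λ i → OnC (D.W (suc s + i))) (λ i → OnC? _) g
    ... | inj₂ never = ⊥-elim (never mg ≤-refl (subst OnC (D.periodic _ _ turn) on-s))
      where
      turn : s % g ≡ (suc s + mg) % g
      turn = trans (sym ([m+n]%n≡m%n s g)) (cong (_% g) (+-suc s mg))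
    ... | inj₁ (i , i<g , (q , q<c , q-i) , before) = combine i (ear-count s i i<g before) (lengths (m<1+n⇒m<n∨m≡n i<g))
      where
      lengths : i < mg ⊎ i ≡ mg → 2 * g ≤ c + 2 * suc i
      lengths (inj₂ refl) = m≤n+m (2 * g) c
      lengths (inj₁ i<mg) =
        ear-bound girth p<c q<c p≢q not-edge′
          (subst₂ (λ x y → Ear x y (suc i)) (sym p-s) (sym q-i) (D-ear s i (s≤s i<mg) before))
        where
        p≢q : p ≢ q
        p≢q refl = ModD.%-shift-≢ s (suc i) (s≤s z≤n) (s≤s i<mg)
          (sym (D.injective _ _ (trans (sym p-s) (trans q-i (cong D.W (sym (+-suc s i)))))))
        not-edge′ : i ≡ 0 → ¬ CEdge (C.W p) (C.W q)
        not-edge′ refl edge = not-edge (subst₂ CEdge p-s (trans q-i (cong D.W (+-identityʳ (suc s)))) edge)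

    bound : 2 * g + c ≤ 2 * n + 2
    bound with least-below (λ s → OnC (D.W s)) (λ s → OnC? _) g
    -- D avoids C: C and g - 1 vertices of D are distinct.
    ... | inj₂ avoids = combine mg (ear-count mg mg ≤-refl off) (m≤n+m (2 * g) c)
      where
      off : ∀ i → i < mg → ¬ OnC (D.W (suc mg + i))
      off i i<mg on = avoids i (<-trans i<mg ≤-refl)
        (subst OnC (D.periodic _ _ (trans (cong (_% g) (+-comm g i)) ([m+n]%n≡m%n i g))) on)
    -- D meets C at s₀; it cannot follow C-edges for a full turn, so at some
    -- first t₁ it leaves C.
    ... | inj₁ (s₀ , _ , on₀ , _)
      with least-below (λ t → ¬ CEdge (D.W (s₀ + t)) (D.W (s₀ + suc t))) (λ t → ¬? (CEdge? _ _)) g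
    ... | inj₂ along = ⊥-elim (Winding.impossible s₀ (λ t t<g → decidable-stable (CEdge? _ _) (along t t<g)))
    ... | inj₁ (t₁ , _ , not-edge , before) =
      leaving-C (s₀ + t₁) (on-C-at t₁ before) (subst (λ x → ¬ CEdge (D.W (s₀ + t₁)) (D.W x)) (+-suc s₀ t₁) not-edge)
      where
      on-C-at : ∀ t → (∀ j → j < t → ¬ ¬ CEdge (D.W (s₀ + j)) (D.W (s₀ + suc j))) → OnC (D.W (s₀ + t))
      on-C-at zero _ = subst OnC (cong D.W (sym (+-identityʳ s₀))) on₀
      on-C-at (suc t) edges with decidable-stable (CEdge? _ _) (edges t ≤-refl)
      ... | p , _ , inj₁ (_ , to) = on-C (suc p) to
      ... | p , _ , inj₂ (to , _) = on-C p to

module Numbered (n' : ℕ) where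
  vx : ℕ → Fin (suc n')
  vx t = fromℕ< (m%n<n t (suc n'))

  toℕ-vx : ∀ {t} → t < suc n' → toℕ (vx t) ≡ t
  toℕ-vx {t} t<n = trans (Fin.toℕ-fromℕ< (m%n<n t (suc n'))) (m<n⇒m%n≡m t<n)

  ≡-vx : ∀ {v : Fin (suc n')} {j} → toℕ v ≡ j → v ≡ vx j
  ≡-vx {v} refl = Fin.toℕ-injective (sym (toℕ-vx (Fin.toℕ<n v)))

  vx-injective : ∀ {u v} → u < suc n' → v < suc n' → vx u ≡ vx v → u ≡ v
  vx-injective u<n v<n eq = trans (sym (toℕ-vx u<n)) (trans (cong toℕ eq) (toℕ-vx v<n))

-- The graph Θ on n = suc n' vertices: three branches between the vertices 0
-- and a, namely the two arcs 0, 1, …, a and 0, c - 1, …, a of a c-cycle and a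
-- bridge 0, c, c + 1, …, c + e - 1, a (a chord when e = 0), with the
-- vertices c + e, …, n - 1 pendant at 0.  Every cycle of Θ is the union of
-- two branches; both constructions of the sufficiency proof are such graphs.
module Theta (n' c a e : ℕ) (0<a : 0 < a) (a<c : a < c) (c+e≤n : c + e ≤ suc n') where
  open Numbered n'

  data Branch : Set where
    short long bridge : Branch

  L : Branch → ℕ
  L short  = a
  L long   = c ∸ a
  L bridge = suc e

  bridge-vertex : ℕ → ℕ
  bridge-vertex t with t <? e
  ... | yes _ = c + t
  ... | no _ = a

  p : Branch → ℕ → ℕ
  p short  t       = t
  p long   zero    = 0
  p long   (suc t) = c ∸ suc t
  p bridge zero    = 0
  p bridge (suc t) = bridge-vertex t

  bridge-inner : ∀ {t} → t < e → bridge-vertex t ≡ c + t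
  bridge-inner {t} t<e with t <? e
  ... | yes _ = refl
  ... | no t≮e = ⊥-elim (t≮e t<e)

  bridge-end : bridge-vertex e ≡ a
  bridge-end with e <? e
  ... | yes e<e = ⊥-elim (<-irrefl refl e<e)
  ... | no _ = refl

  p-long : ∀ {t} → 0 < t → p long t ≡ c ∸ t
  p-long {suc t} _ = refl

  0<L : ∀ i → 0 < L i
  0<L short  = 0<a
  0<L long   = m<n⇒0<n∸m a<c
  0<L bridge = s≤s z≤n

  p-start : ∀ i → p i 0 ≡ 0
  p-start short  = refl
  p-start long   = refl
  p-start bridge = refl

  p-end : ∀ i → p i (L i) ≡ a
  p-end short  = refl
  p-end long   = trans (p-long (0<L long)) (m∸[m∸n]≡n (<⇒≤ a<c))
  p-end bridge = bridge-end

  lo hi : Branch → ℕ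
  lo short  = 1
  lo long   = suc a
  lo bridge = c
  hi short  = a
  hi long   = c
  hi bridge = c + e

  inner-range : ∀ i {j} → Inner (L i) j → lo i ≤ p i j × p i j < hi i
  inner-range short inner = inner
  inner-range long {suc j} (_ , 1+j<L) =
    m+n≤o⇒m≤o∸n (suc a) (subst (_≤ c) (cong suc (+-comm (suc j) a)) (m≤o∸n⇒m+n≤o (suc (suc j)) (<⇒≤ a<c) 1+j<L)) ,
    ∸-monoʳ-< (s≤s z≤n) (≤-trans (≤-trans (n≤1+n _) 1+j<L) (m∸n≤m c a))
  inner-range bridge {suc j} (_ , s≤s j<e) rewrite bridge-inner j<e = m≤m+n c j , +-monoʳ-< c j<e

  same-or-separated : ∀ i i' → i ≡ i' ⊎ (hi i ≤ lo i' ⊎ hi i' ≤ lo i)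
  same-or-separated short  short  = inj₁ refl
  same-or-separated long   long   = inj₁ refl
  same-or-separated bridge bridge = inj₁ refl
  same-or-separated short  long   = inj₂ (inj₁ (n≤1+n a))
  same-or-separated long   short  = inj₂ (inj₂ (n≤1+n a))
  same-or-separated short  bridge = inj₂ (inj₁ (<⇒≤ a<c))
  same-or-separated bridge short  = inj₂ (inj₂ (<⇒≤ a<c))
  same-or-separated long   bridge = inj₂ (inj₁ ≤-refl)
  same-or-separated bridge long   = inj₂ (inj₂ ≤-refl)

  0<lo : ∀ i → 0 < lo i
  0<lo short  = s≤s z≤n
  0<lo long   = s≤s z≤n
  0<lo bridge = ≤-<-trans z≤n a<c

  a-outside : ∀ i → a < lo i ⊎ hi i ≤ a
  a-outside short  = inj₂ ≤-refl
  a-outside long   = inj₁ ≤-refl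
  a-outside bridge = inj₁ a<c

  hi≤c+e : ∀ i → hi i ≤ c + e
  hi≤c+e short  = ≤-trans (<⇒≤ a<c) (m≤m+n c e)
  hi≤c+e long   = m≤m+n c e
  hi≤c+e bridge = ≤-refl

  inner-≢0 : ∀ i {j} → Inner (L i) j → p i j ≢ 0
  inner-≢0 i inner eq = <⇒≢ (<-≤-trans (0<lo i) (proj₁ (inner-range i inner))) (sym eq)

  inner-≢a : ∀ i {j} → Inner (L i) j → p i j ≢ a
  inner-≢a i inner eq with a-outside i
  ... | inj₁ a<lo = <⇒≢ (<-≤-trans a<lo (proj₁ (inner-range i inner))) (sym eq)
  ... | inj₂ hi≤a = <⇒≢ (<-≤-trans (proj₂ (inner-range i inner)) hi≤a) eq

  inner-injective : ∀ i → InjectiveOn (Inner (L i)) (p i)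
  inner-injective short _ _ _ _ eq = eq
  inner-injective long (suc j) (suc j') (_ , j<) (_ , j'<) eq =
    ∸-cancelˡ-≡ (≤-trans (<⇒≤ j<) (m∸n≤m c a)) (≤-trans (<⇒≤ j'<) (m∸n≤m c a)) eq
  inner-injective bridge (suc j) (suc j') (_ , s≤s j<e) (_ , s≤s j'<e) eq =
    cong suc (+-cancelˡ-≡ c _ _ (trans (sym (bridge-inner j<e)) (trans eq (bridge-inner j'<e))))

  inner-unique : ∀ i i' {j j'} → Inner (L i) j → Inner (L i') j' → p i j ≡ p i' j' → i ≡ i' × j ≡ j'
  inner-unique i i' inner inner' eq with same-or-separated i i'
  ... | inj₁ refl = refl , inner-injective i _ _ inner inner' eq
  ... | inj₂ (inj₁ hi≤lo') = ⊥-elim (<⇒≢ (<-≤-trans (proj₂ (inner-range i inner))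
          (≤-trans hi≤lo' (proj₁ (inner-range i' inner')))) eq)
  ... | inj₂ (inj₂ hi'≤lo) = ⊥-elim (<⇒≢ (<-≤-trans (proj₂ (inner-range i' inner'))
          (≤-trans hi'≤lo (proj₁ (inner-range i inner)))) (sym eq))

  InnerVertex : ℕ → Set
  InnerVertex v = Σ Branch λ i → Σ ℕ λ j → Inner (L i) j × p i j ≡ v

  decode : ∀ v → v < c + e → v ≡ 0 ⊎ v ≡ a ⊎ InnerVertex v
  decode v v<c+e with v ≟ 0 | v <? a | v ≟ a | v <? c
  ... | yes v≡0 | _ | _ | _ = inj₁ v≡0
  ... | no v≢0 | yes v<a | _ | _ = inj₂ (inj₂ (short , v , (n≢0⇒n>0 v≢0 , v<a) , refl))
  ... | no _ | no _ | yes v≡a | _ = inj₂ (inj₁ v≡a)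
  ... | no _ | no v≮a | no v≢a | yes v<c =
    inj₂ (inj₂ (long , c ∸ v , (m<n⇒0<n∸m v<c , ∸-monoʳ-< a<v (<⇒≤ v<c)) ,
                trans (p-long (m<n⇒0<n∸m v<c)) (m∸[m∸n]≡n (<⇒≤ v<c))))
    where
    a<v : a < v
    a<v = ≤∧≢⇒< (≮⇒≥ v≮a) (v≢a ∘ sym)
  ... | no _ | no _ | no _ | no v≮c =
    inj₂ (inj₂ (bridge , suc (v ∸ c) , (s≤s z≤n , s≤s v∸c<e) ,
                trans (bridge-inner v∸c<e) (m+[n∸m]≡n (≮⇒≥ v≮c))))
    where
    v∸c<e : v ∸ c < e
    v∸c<e = +-cancelˡ-< c _ _ (subst (_< c + e) (sym (m+[n∸m]≡n (≮⇒≥ v≮c))) v<c+e)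

  p-bound : ∀ i {t} → t ≤ L i → p i t < c + e
  p-bound i t≤L with position-cases t≤L
  ... | inj₁ refl = subst (_< c + e) (sym (p-start i)) (≤-<-trans z≤n (<-≤-trans a<c (m≤m+n c e)))
  ... | inj₂ (inj₁ refl) = subst (_< c + e) (sym (p-end i)) (<-≤-trans a<c (m≤m+n c e))
  ... | inj₂ (inj₂ inner) = <-≤-trans (proj₂ (inner-range i inner)) (hi≤c+e i)

  p-zero : ∀ i {t} → t ≤ L i → p i t ≡ 0 → t ≡ 0
  p-zero i t≤L eq with position-cases t≤L
  ... | inj₁ t≡0 = t≡0
  ... | inj₂ (inj₁ refl) = ⊥-elim (<⇒≢ 0<a (sym (trans (sym (p-end i)) eq)))
  ... | inj₂ (inj₂ inner) = ⊥-elim (inner-≢0 i inner eq)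

  p-a : ∀ i {t} → t ≤ L i → p i t ≡ a → t ≡ L i
  p-a i t≤L eq with position-cases t≤L
  ... | inj₁ refl = ⊥-elim (<⇒≢ 0<a (trans (sym (p-start i)) eq))
  ... | inj₂ (inj₁ t≡L) = t≡L
  ... | inj₂ (inj₂ inner) = ⊥-elim (inner-≢a i inner eq)

  p-injective : ∀ i → InjectiveOn (_≤ L i) (p i)
  p-injective i t t' t≤L t'≤L eq with position-cases t≤L
  ... | inj₁ refl = sym (p-zero i t'≤L (trans (sym eq) (p-start i)))
  ... | inj₂ (inj₁ refl) = sym (p-a i t'≤L (trans (sym eq) (p-end i)))
  ... | inj₂ (inj₂ inner) with position-cases t'≤L
  ...   | inj₁ refl = ⊥-elim (inner-≢0 i inner (trans eq (p-start i)))
  ...   | inj₂ (inj₁ refl) = ⊥-elim (inner-≢a i inner (trans eq (p-end i)))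
  ...   | inj₂ (inj₂ inner') = proj₂ (inner-unique i i inner inner' eq)

  locate : ∀ i i' {j t} → Inner (L i) j → t ≤ L i' → p i' t ≡ p i j → i' ≡ i × t ≡ j
  locate i i' inner t≤L eq with position-cases t≤L
  ... | inj₁ refl = ⊥-elim (inner-≢0 i inner (trans (sym eq) (p-start i')))
  ... | inj₂ (inj₁ refl) = ⊥-elim (inner-≢a i inner (trans (sym eq) (p-end i')))
  ... | inj₂ (inj₂ inner') = inner-unique i' i inner' inner eq

  BranchStep : ℕ → ℕ → Set
  BranchStep u v = Σ Branch λ i → Σ ℕ λ t → t < L i × p i t ≡ u × p i (suc t) ≡ v

  data Edge (u v : ℕ) : Set where
    branch  : BranchStep u v → Edge u v
    pendant : u ≡ 0 → c + e ≤ v → Edge u v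

  Linked : ℕ → ℕ → Set
  Linked u v = Edge u v ⊎ Edge v u

  edge-irreflexive : ∀ {u} → ¬ Edge u u
  edge-irreflexive (branch (i , t , t<L , refl , eq)) =
    <⇒≢ (n<1+n t) (p-injective i _ _ (<⇒≤ t<L) t<L (sym eq))
  edge-irreflexive (pendant refl c+e≤0) = <⇒≱ (<-≤-trans (≤-<-trans z≤n a<c) (m≤m+n c e)) c+e≤0

  G : Graph (suc n')
  G = record
    { Adj   = λ u v → Linked (toℕ u) (toℕ v)
    ; sym   = swap
    ; irref = λ { (inj₁ loop) → edge-irreflexive loop ; (inj₂ loop) → edge-irreflexive loop }
    }

  p<n : ∀ i {t} → t ≤ L i → p i t < suc n'
  p<n i t≤L = <-≤-trans (p-bound i t≤L) c+e≤n

  branch-walk : ∀ i → IsWalk G (vx ∘ p i) (L i)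
  branch-walk i t t<L =
    inj₁ (branch (i , t , t<L , sym (toℕ-vx (p<n i (<⇒≤ t<L))) , sym (toℕ-vx (p<n i t<L))))

  inner-neighbours : ∀ i {j v} → Inner (L i) j → Linked (p i j) v → v ≡ p i (pred j) ⊎ v ≡ p i (suc j)
  inner-neighbours i inner (inj₁ (branch (i' , t , t<L , this , next))) with locate i i' inner (<⇒≤ t<L) this
  ... | refl , refl = inj₂ (sym next)
  inner-neighbours i inner (inj₂ (branch (i' , t , t<L , prev , this))) with locate i i' inner t<L this
  ... | refl , refl = inj₁ (sym prev)
  inner-neighbours i inner (inj₁ (pendant is0 _)) = ⊥-elim (inner-≢0 i inner is0)
  inner-neighbours i inner (inj₂ (pendant _ far)) = ⊥-elim (<⇒≱ (p-bound i (<⇒≤ (proj₂ inner))) far)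

  zero-neighbours : ∀ {v} → Linked 0 v → (Σ Branch λ i → v ≡ p i 1) ⊎ c + e ≤ v
  zero-neighbours (inj₁ (branch (i , t , t<L , this , next))) with p-zero i (<⇒≤ t<L) this
  ... | refl = inj₁ (i , sym next)
  zero-neighbours (inj₂ (branch (i , t , t<L , _ , this))) = ⊥-elim (1+n≢0 (p-zero i t<L this))
  zero-neighbours (inj₁ (pendant _ far)) = inj₂ far
  zero-neighbours (inj₂ (pendant refl c+e≤0)) = inj₂ c+e≤0

  pendant-neighbours : ∀ {u v} → c + e ≤ u → Linked u v → v ≡ 0
  pendant-neighbours far (inj₁ (branch (i , t , t<L , this , _))) =
    ⊥-elim (<⇒≱ (subst (_< c + e) this (p-bound i (<⇒≤ t<L))) far)
  pendant-neighbours far (inj₂ (branch (i , t , t<L , _ , this))) =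
    ⊥-elim (<⇒≱ (subst (_< c + e) this (p-bound i t<L)) far)
  pendant-neighbours far (inj₁ (pendant refl _)) = ⊥-elim (<⇒≱ (<-≤-trans (≤-<-trans z≤n a<c) (m≤m+n c e)) far)
  pendant-neighbours far (inj₂ (pendant v≡0 _)) = v≡0

  connected : Connected G
  connected = connected-via-root (vx 0) reach
    where
    0<n : 0 < suc n'
    0<n = s≤s z≤n
    along : ∀ i t → t ≤ L i → Reach G (vx (p i t)) (vx 0)
    along i zero _ = subst (λ x → Reach G (vx x) (vx 0)) (sym (p-start i)) here
    along i (suc t) 1+t≤L = step (adj-sym G (branch-walk i t 1+t≤L)) (along i t (<⇒≤ 1+t≤L))
    reach : ∀ v → Reach G v (vx 0)
    reach v with toℕ v <? c + e
    ... | no far = step (inj₂ (pendant (toℕ-vx 0<n) (≮⇒≥ far))) here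
    ... | yes near with decode (toℕ v) near
    ...   | inj₁ v≡0 = subst (λ w → Reach G w (vx 0)) (sym (≡-vx v≡0)) here
    ...   | inj₂ (inj₁ v≡a) = subst (λ w → Reach G w (vx 0)) (sym (≡-vx v≡a)) (along short a ≤-refl)
    ...   | inj₂ (inj₂ (i , j , inner , pj≡v)) =
      subst (λ w → Reach G w (vx 0)) (sym (≡-vx (sym pj≡v))) (along i j (<⇒≤ (proj₂ inner)))

  back : Branch → ℕ → Fin (suc n')
  back i' x = vx (p i' (L i' ∸ x))

  branch-injective : ∀ i → InjectiveOn (_≤ L i) (vx ∘ p i)
  branch-injective i t t' t≤L t'≤L eq = p-injective i t t' t≤L t'≤L (vx-injective (p<n i t≤L) (p<n i t'≤L) eq)

  back-injective : ∀ i' → InjectiveOn (Inner (L i')) (back i')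
  back-injective i' = mirror-injective (vx ∘ p i') λ j j' inner inner' eq →
    inner-injective i' j j' inner inner' (vx-injective (p<n i' (<⇒≤ (proj₂ inner))) (p<n i' (<⇒≤ (proj₂ inner'))) eq)

  branches-disjoint : ∀ {i i'} → i ≢ i' → ∀ x y → x ≤ L i → Inner (L i') y → vx (p i x) ≢ back i' y
  branches-disjoint {i} {i'} i≢i' x y x≤L inner eq = i≢i' (proj₁ (locate i' i (mirror inner) x≤L
    (vx-injective (p<n i x≤L) (p<n i' (<⇒≤ (proj₂ (mirror inner)))) eq)))

  branch-cycle : ∀ i i' → i ≢ i' → 3 ≤ L i + L i' → Cycle G (L i + L i')
  branch-cycle i i' i≢i' 3≤ = two-walks⇒cycle {G = G} (L i) (L i') (vx ∘ p i) (back i') (0<L i') 3≤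
    (branch-walk i) (reverse-walk {G = G} {vx ∘ p i'} (branch-walk i'))
    (cong vx (trans (p-end i) (sym (p-end i'))))
    (cong vx (trans (cong (p i') (n∸n≡0 (L i'))) (trans (p-start i') (sym (p-start i)))))
    (branch-injective i) (back-injective i') (branches-disjoint i≢i')

  union : Branch → Branch → ℕ → Fin (suc n')
  union i i' = Splice.splice (L i) (vx ∘ p i) (back i')

  union-injective : ∀ {i i'} → i ≢ i' → InjectiveOn (_< L i + L i') (union i i')
  union-injective {i} {i'} i≢i' =
    Splice.splice-injective (L i) (vx ∘ p i) (back i') (L i') (branch-injective i) (back-injective i') (branches-disjoint i≢i')

  module OnAnyCycle {m} (2≤m : 2 ≤ m) (C : CyclicWalk G m) where
    open OnCyclicWalk 2≤m C

    -- Pendant vertices have degree one, so the cycle avoids them.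
    in-core : ∀ t → toℕ (W t) < c + e
    in-core t with toℕ (W t) <? c + e
    ... | yes near = near
    ... | no far = ⊥-elim (no-pendant-on-cycle t λ x adj → ≡-vx (pendant-neighbours (≮⇒≥ far) adj))

    Full : Branch → Set
    Full i = ∀ t → t ≤ L i → OnCycle (vx (p i t))

    -- Inner vertices have degree two, so through one of them the cycle runs
    -- along the whole branch.
    inner-full : ∀ i {j} → Inner (L i) j → OnCycle (vx (p i j)) → Full i
    inner-full i {j} inner on = propagate (λ t → OnCycle (vx (p i t))) (L i) spread j inner on
      where
      spread : ∀ t → Inner (L i) t → OnCycle (vx (p i t)) →
               OnCycle (vx (p i (pred t))) × OnCycle (vx (p i (suc t)))
      spread t inner-t (s , Ws) = degree-two-on-cycle s λ x adj → map-⊎ ≡-vx ≡-vx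
        (inner-neighbours i inner-t (subst (λ y → Linked y (toℕ x))
          (trans (cong toℕ Ws) (toℕ-vx (p<n i (<⇒≤ (proj₂ inner-t))))) adj))

    -- The cycle is not confined to {0, a}, so some branch is full; in
    -- particular the cycle passes through 0.
    some-full : Σ Branch Full
    some-full = not-within-two (vx 0) (vx a) classify
      where
      classify : ∀ t → (W t ≡ vx 0 ⊎ W t ≡ vx a) ⊎ Σ Branch Full
      classify t with decode (toℕ (W t)) (in-core t)
      ... | inj₁ is0 = inj₁ (inj₁ (≡-vx is0))
      ... | inj₂ (inj₁ isa) = inj₁ (inj₂ (≡-vx isa))
      ... | inj₂ (inj₂ (i , j , inner , pj)) = inj₂ (i , inner-full i inner (t , ≡-vx (sym pj)))

    passes-0 : Σ ℕ λ s → W s ≡ vx 0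
    passes-0 with proj₂ some-full 0 z≤n
    ... | s , Ws = s , trans Ws (cong vx (p-start (proj₁ some-full)))

    s : ℕ
    s = proj₁ passes-0

    first-vertex : ∀ {x} → Adj G (W s) x → OnCycle x → Σ Branch λ i → x ≡ vx (p i 1)
    first-vertex adj (t , refl)
      with zero-neighbours (subst (λ y → Linked y (toℕ (W t))) (trans (cong toℕ (proj₂ passes-0)) (toℕ-vx (s≤s z≤n))) adj)
    ... | inj₁ (i , eq) = i , ≡-vx eq
    ... | inj₂ far = ⊥-elim (<⇒≱ (in-core t) far)

    next : Σ Branch λ i → W (suc s) ≡ vx (p i 1)
    next = first-vertex (adj s) (suc s , refl)

    prev : Σ Branch λ i → W (s + m) ≡ vx (p i 1)
    prev = first-vertex (adj-sym G (adj-pred s)) (s + m , refl)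

    i₁ i₂ : Branch
    i₁ = proj₁ next
    i₂ = proj₁ prev

    distinct-firsts : p i₁ 1 ≢ p i₂ 1
    distinct-firsts eq = neighbours-≢ s (trans (proj₂ next) (trans (cong vx eq) (sym (proj₂ prev))))

    first-full : ∀ i → OnCycle (vx (p i 1)) → Full i
    first-full i on₁ with position-cases (0<L i)
    ... | inj₂ (inj₂ inner) = inner-full i inner on₁
    ... | inj₂ (inj₁ 1≡L) = full
      where
      full : Full i
      full zero _ = subst (OnCycle ∘ vx) (sym (p-start i)) (s , proj₂ passes-0)
      full (suc zero) _ = on₁
      full (suc (suc t)) 2+t≤L = ⊥-elim (<⇒≱ (s≤s (s≤s z≤n)) (subst (suc (suc t) ≤_) (sym 1≡L) 2+t≤L))

    full₁ : Full i₁
    full₁ = first-full i₁ (suc s , proj₂ next)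

    full₂ : Full i₂
    full₂ = first-full i₂ (s + m , proj₂ prev)

    -- A third branch met in an inner vertex would have its first vertex as a
    -- third cycle-neighbour of 0.
    only-two : ∀ i {j} → Inner (L i) j → OnCycle (vx (p i j)) → i ≡ i₁ ⊎ i ≡ i₂
    only-two i {j} inner on = map-⊎ (same-branch next) (same-branch prev)
      (degree-two-neighbour s (inner-full i inner on 1 (<⇒≤ (proj₂ inner₁))) neighbours₁)
      where
      inner₁ : Inner (L i) 1
      inner₁ = s≤s z≤n , ≤-<-trans (proj₁ inner) (proj₂ inner)
      neighbours₁ : Neighbours⊆ (vx (p i 1)) (W s) (vx (p i 2))
      neighbours₁ x adj = map-⊎ (λ eq → trans (≡-vx (trans eq (p-start i))) (sym (proj₂ passes-0))) ≡-vx
        (inner-neighbours i inner₁ (subst (λ y → Linked y (toℕ x)) (toℕ-vx (p<n i (<⇒≤ (proj₂ inner₁)))) adj))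
      same-branch : ∀ {y} → (nb : Σ Branch λ i' → y ≡ vx (p i' 1)) → vx (p i 1) ≡ y → i ≡ proj₁ nb
      same-branch (i' , y≡) eq = sym (proj₁ (locate i i' inner₁ (0<L i')
        (vx-injective (p<n i' (0<L i')) (p<n i (<⇒≤ (proj₂ inner₁))) (sym (trans eq y≡)))))

    module Union (i₁ i₂ : Branch) (i₁≢i₂ : i₁ ≢ i₂) (full₁ : Full i₁) (full₂ : Full i₂)
                 (only : ∀ i {j} → Inner (L i) j → OnCycle (vx (p i j)) → i ≡ i₁ ⊎ i ≡ i₂) where
      open Splice (L i₁) (vx ∘ p i₁) (back i₂)

      covered : ∀ t → Σ ℕ λ x → x < L i₁ + L i₂ × splice x ≡ W t
      covered t with decode (toℕ (W t)) (in-core t)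
      ... | inj₁ is0 = 0 , <-≤-trans (0<L i₁) (m≤m+n _ _) ,
            trans (splice-≤ z≤n) (trans (cong vx (p-start i₁)) (sym (≡-vx is0)))
      ... | inj₂ (inj₁ isa) = L i₁ , m<m+n (L i₁) (0<L i₂) ,
            trans (splice-≤ ≤-refl) (trans (cong vx (p-end i₁)) (sym (≡-vx isa)))
      ... | inj₂ (inj₂ (i , j , inner , pj)) = by-branch (only i inner (t , ≡-vx (sym pj)))
        where
        W≡ : vx (p i j) ≡ W t
        W≡ = sym (≡-vx (sym pj))
        by-branch : i ≡ i₁ ⊎ i ≡ i₂ → Σ ℕ λ x → x < L i₁ + L i₂ × splice x ≡ W t
        by-branch (inj₁ refl) = j , <-≤-trans (proj₂ inner) (m≤m+n _ _) , trans (splice-≤ (<⇒≤ (proj₂ inner))) W≡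
        by-branch (inj₂ refl) = L i₁ + (L i₂ ∸ j) , +-monoʳ-< (L i₁) (∸-monoʳ-< (proj₁ inner) (<⇒≤ (proj₂ inner))) ,
          trans (splice-> (<⇒≱ (m<m+n (L i₁) (m<n⇒0<n∸m (proj₂ inner)))))
            (trans (cong (λ y → vx (p i₂ (L i₂ ∸ y))) (m+n∸m≡n (L i₁) (L i₂ ∸ j)))
              (trans (cong (vx ∘ p i₂) (m∸[m∸n]≡n (<⇒≤ (proj₂ inner)))) W≡))

      on-union : ∀ x → x < L i₁ + L i₂ → OnCycle (splice x)
      on-union x _ = by-part (x ≤? L i₁)
        where
        by-part : Dec (x ≤ L i₁) → OnCycle (splice x)
        by-part (yes x≤L) = subst OnCycle (sym (splice-≤ x≤L)) (full₁ x x≤L)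
        by-part (no x≰L) = subst OnCycle (sym (splice-> x≰L)) (full₂ _ (m∸n≤m (L i₂) (x ∸ L i₁)))

      length : k ≡ L i₁ + L i₂
      length = ≤-antisym (length-≤-cover splice _ covered)
        (on-cycle-count splice _ (union-injective i₁≢i₂) on-union)

    length : k ≡ L i₁ + L i₂
    length = Union.length i₁ i₂ (distinct-firsts ∘ cong (λ i → p i 1)) full₁ full₂ only-two

  every-cycle : ∀ k → Cycle G k → Σ Branch λ i₁ → Σ Branch λ i₂ → p i₁ 1 ≢ p i₂ 1 × k ≡ L i₁ + L i₂
  every-cycle k cycle with cycle⇒cyclicWalk {G = G} cycle
  ... | m , refl , 2≤m , W = i₁ , i₂ , distinct-firsts , length
    where open OnAnyCycle 2≤m W

  admissible : ∀ g i i' → i ≢ i' → 3 ≤ g → L i + L i' ≡ g → 3 ≤ c →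
               (∀ i₁ i₂ → p i₁ 1 ≢ p i₂ 1 → g ≤ L i₁ + L i₂ × L i₁ + L i₂ ≤ c) →
               VAdmissible g c (suc n')
  admissible g i i' i≢i' 3≤g pair≡g 3≤c between =
    G , connected ,
    (subst (Cycle G) pair≡g (branch-cycle i i' i≢i' (subst (3 ≤_) (sym pair≡g) 3≤g)) ,
     λ k cycle → proj₁ (bounds k cycle)) ,
    (subst (Cycle G) arcs≡c (branch-cycle short long (λ ()) (subst (3 ≤_) (sym arcs≡c) 3≤c)) ,
     λ k cycle → proj₂ (bounds k cycle))
    where
    arcs≡c : L short + L long ≡ c
    arcs≡c = m+[n∸m]≡n (<⇒≤ a<c)
    bounds : ∀ k → Cycle G k → g ≤ k × k ≤ c
    bounds k cycle with every-cycle k cycle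
    ... | i₁ , i₂ , firsts , refl = between i₁ i₂ firsts

-- g = c: the c-cycle with pendant vertices, i.e. Θ with a = 1 and e = 0,
-- whose bridge is the edge 0 1 of the short arc.  Its only cycle is the
-- c-cycle.
ring-admissible : ∀ c n' → 3 ≤ c → c ≤ suc n' → VAdmissible c c (suc n')
ring-admissible c n' 3≤c c≤n =
  admissible c short long (λ ()) 3≤c (m+[n∸m]≡n 1≤c) 3≤c
    λ i₁ i₂ firsts → ≤-reflexive (sym (length≡c i₁ i₂ firsts)) , ≤-reflexive (length≡c i₁ i₂ firsts)
  where
  1≤c : 1 ≤ c
  1≤c = ≤-trans (s≤s z≤n) 3≤c
  open Theta n' c 1 0 (s≤s z≤n) (≤-trans (s≤s (s≤s z≤n)) 3≤c) (subst (_≤ suc n') (sym (+-identityʳ c)) c≤n)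
  length≡c : ∀ i₁ i₂ → p i₁ 1 ≢ p i₂ 1 → L i₁ + L i₂ ≡ c
  length≡c short  long   _ = m+[n∸m]≡n 1≤c
  length≡c long   short  _ = trans (+-comm (c ∸ 1) 1) (m+[n∸m]≡n 1≤c)
  length≡c long   bridge _ = trans (+-comm (c ∸ 1) 1) (m+[n∸m]≡n 1≤c)
  length≡c bridge long   _ = m+[n∸m]≡n 1≤c
  length≡c short  bridge firsts = ⊥-elim (firsts (sym bridge-end))
  length≡c bridge short  firsts = ⊥-elim (firsts bridge-end)
  length≡c short  short  firsts = ⊥-elim (firsts refl)
  length≡c long   long   firsts = ⊥-elim (firsts refl)
  length≡c bridge bridge firsts = ⊥-elim (firsts refl)

-- g < c: Θ with 2 ≤ a ≤ c - a and a bridge of length e + 1 ≤ a.  The short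
-- arc and the bridge form a shortest cycle (length a + e + 1), the two arcs a
-- longest one (length c).
theta-admissible : ∀ n' c a e → 2 ≤ a → e < a → a + a ≤ c → c + e ≤ suc n' →
                   VAdmissible (a + suc e) c (suc n')
theta-admissible n' c a e 2≤a e<a a+a≤c c+e≤n =
  admissible (a + suc e) short bridge (λ ()) (+-mono-≤ 2≤a (s≤s z≤n)) refl (≤-trans (s≤s 2≤a) a<c) between
  where
  a<c : a < c
  a<c = <-≤-trans (m<m+n a (≤-trans (s≤s z≤n) 2≤a)) a+a≤c
  open Theta n' c a e (≤-trans (s≤s z≤n) 2≤a) a<c c+e≤n
  g≤c : a + suc e ≤ c
  g≤c = ≤-trans (+-monoʳ-≤ a e<a) a+a≤c
  a≤c∸a : a ≤ c ∸ a
  a≤c∸a = m+n≤o⇒m≤o∸n a a+a≤c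
  long+bridge≤c : (c ∸ a) + suc e ≤ c
  long+bridge≤c = ≤-trans (+-monoʳ-≤ (c ∸ a) e<a) (≤-reflexive (m∸n+n≡m (<⇒≤ a<c)))
  between : ∀ i₁ i₂ → p i₁ 1 ≢ p i₂ 1 → a + suc e ≤ L i₁ + L i₂ × L i₁ + L i₂ ≤ c
  between short  long   _ = ≤-trans g≤c (≤-reflexive (sym (m+[n∸m]≡n (<⇒≤ a<c)))) , ≤-reflexive (m+[n∸m]≡n (<⇒≤ a<c))
  between long   short  _ = ≤-trans g≤c (≤-reflexive (sym (m∸n+n≡m (<⇒≤ a<c)))) , ≤-reflexive (m∸n+n≡m (<⇒≤ a<c))
  between short  bridge _ = ≤-refl , g≤c
  between bridge short  _ = ≤-reflexive (+-comm a (suc e)) , subst (_≤ c) (+-comm a (suc e)) g≤c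
  between long   bridge _ = +-monoˡ-≤ (suc e) a≤c∸a , long+bridge≤c
  between bridge long   _ = subst (a + suc e ≤_) (+-comm (c ∸ a) (suc e)) (+-monoˡ-≤ (suc e) a≤c∸a) ,
                            subst (_≤ c) (+-comm (c ∸ a) (suc e)) long+bridge≤c
  between short  short  firsts = ⊥-elim (firsts refl)
  between long   long   firsts = ⊥-elim (firsts refl)
  between bridge bridge firsts = ⊥-elim (firsts refl)

halve : ∀ c → ⌊ c /2⌋ + ⌊ c /2⌋ ≤ c × c ≤ suc (⌊ c /2⌋ + ⌊ c /2⌋)
halve c =
  ≤-trans (+-monoʳ-≤ ⌊ c /2⌋ (⌊n/2⌋≤⌈n/2⌉ c)) (≤-reflexive (⌊n/2⌋+⌈n/2⌉≡n c)) ,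
  ≤-trans (≤-reflexive (sym (⌊n/2⌋+⌈n/2⌉≡n c)))
    (≤-trans (+-monoʳ-≤ ⌊ c /2⌋ (⌊n/2⌋-mono (n≤1+n (suc c)))) (≤-reflexive (+-suc ⌊ c /2⌋ ⌊ c /2⌋)))

bridge-fits : ∀ c h e n → c ≤ suc (h + h) → 2 * suc (h + e) + c ≤ 2 * n + 2 → c + e ≤ n
bridge-fits c h e n c≤2h+1 bound = ≤-pred (*-cancelˡ-< 2 (c + e) (suc n) (begin-strict
  2 * (c + e)                   ≡⟨ double c e ⟩
  c + (c + 2 * e)               ≤⟨ +-monoʳ-≤ c (+-monoˡ-≤ (2 * e) c≤2h+1) ⟩
  c + (suc (h + h) + 2 * e)     ≡⟨ regroup c h e ⟩
  suc (2 * (h + e) + c)         ≤⟨ s≤s (+-cancelʳ-≤ 2 _ _ (subst (_≤ 2 * n + 2) (shift h e c) bound)) ⟩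
  suc (2 * n)                   <⟨ ≤-reflexive (sym (*-suc 2 n)) ⟩
  2 * suc n                     ∎))
  where
  open ≤-Reasoning
  double : ∀ c e → 2 * (c + e) ≡ c + (c + 2 * e)
  double = solve-∀
  regroup : ∀ c h e → c + (suc (h + h) + 2 * e) ≡ suc (2 * (h + e) + c)
  regroup = solve-∀
  shift : ∀ h e c → 2 * suc (h + e) + c ≡ 2 * (h + e) + c + 2
  shift = solve-∀

-- If g - 1 ≤ ⌊c/2⌋ take
-- a = g - 1 and a chord (e = 0); otherwise a = ⌊c/2⌋.
theta-parameters : ∀ a₀ c n → 2 ≤ a₀ → suc a₀ < c → c ≤ n → 2 * suc a₀ + c ≤ 2 * n + 2 →
                   Σ ℕ λ a → Σ ℕ λ e → 2 ≤ a × e < a × a + a ≤ c × c + e ≤ n × a + suc e ≡ suc a₀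
theta-parameters a₀ c n 2≤a₀ g<c c≤n bound with a₀ ≤? ⌊ c /2⌋
... | yes a₀≤h = a₀ , 0 , 2≤a₀ , ≤-trans (s≤s z≤n) 2≤a₀ , ≤-trans (+-mono-≤ a₀≤h a₀≤h) (proj₁ (halve c)) ,
                 subst (_≤ n) (sym (+-identityʳ c)) c≤n , +-comm a₀ 1
... | no a₀≰h = h , e , 2≤h , e<h , proj₁ (halve c) , c+e≤n , trans (+-suc h e) (cong suc h+e≡a₀)
  where
  h = ⌊ c /2⌋
  e = a₀ ∸ h
  h≤a₀ : h ≤ a₀
  h≤a₀ = <⇒≤ (≰⇒> a₀≰h)
  h+e≡a₀ : h + e ≡ a₀
  h+e≡a₀ = m+[n∸m]≡n h≤a₀
  a₀<h+h : a₀ < h + h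
  a₀<h+h = ≤-pred (≤-trans g<c (proj₂ (halve c)))
  2≤h : 2 ≤ h
  2≤h with 2 ≤? h
  ... | yes 2≤h = 2≤h
  ... | no 2≰h = ⊥-elim (<⇒≱ (≤-<-trans 2≤a₀ a₀<h+h) (+-mono-≤ h≤1 h≤1))
    where
    h≤1 : h ≤ 1
    h≤1 = ≤-pred (≰⇒> 2≰h)
  e<h : e < h
  e<h = +-cancelˡ-< h _ _ (subst (_< h + h) (sym h+e≡a₀) a₀<h+h)
  c+e≤n : c + e ≤ n
  c+e≤n = bridge-fits c h e n (proj₂ (halve c)) (subst (λ x → 2 * suc x + c ≤ 2 * n + 2) (sym h+e≡a₀) bound)

necessity : ∀ g c n → VAdmissible g c n → g < c → 2 * g + c ≤ 2 * n + 2
necessity g c n (G , _ , (shortest , girth) , (longest , _)) g<c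
  with cycle⇒cyclicWalk {G = G} shortest | cycle⇒cyclicWalk {G = G} longest
... | mg , refl , 2≤mg , D | mc , refl , _ , C = Necessity.Shortest.bound mc mg 2≤mg g<c C D girth

sufficiency : ∀ g c n → 3 ≤ g → c ≤ n → g ≡ c ⊎ (g < c × 2 * g + c ≤ 2 * n + 2) → VAdmissible g c n
sufficiency g c zero 3≤g c≤0 (inj₁ refl) with ≤-trans 3≤g c≤0
... | ()
sufficiency g c zero 3≤g c≤0 (inj₂ (g<c , _)) with ≤-trans (≤-trans 3≤g (<⇒≤ g<c)) c≤0
... | ()
sufficiency g .g (suc n') 3≤g g≤n (inj₁ refl) = ring-admissible g n' 3≤g g≤n
sufficiency (suc a₀) c (suc n') (s≤s 2≤a₀) c≤n (inj₂ (g<c , bound))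
  with theta-parameters a₀ c (suc n') 2≤a₀ g<c c≤n bound
... | a , e , 2≤a , e<a , a+a≤c , c+e≤n , g≡ =
  subst (λ g → VAdmissible g c (suc n')) g≡ (theta-admissible n' c a e 2≤a e<a a+a≤c c+e≤n)

lemma2p12 : (g c n : ℕ) → 3 ≤ g → g ≤ c → c ≤ n →
    VAdmissible g c n ⇔ (g ≡ c ⊎ (g < c × 2 * g + c ≤ 2 * n + 2))
lemma2p12 g c n 3≤g g≤c c≤n = mk⇔ classify (sufficiency g c n 3≤g c≤n)
  where
  classify : VAdmissible g c n → g ≡ c ⊎ (g < c × 2 * g + c ≤ 2 * n + 2)
  classify admissible with g ≟ c
  ... | yes g≡c = inj₁ g≡c
  ... | no g≢c = inj₂ (g<c , necessity g c n admissible g<c)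
    where
    g<c : g < c
    g<c = ≤∧≢⇒< g≤c g≢c
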